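{- Every graph that is palindromic or antipalindromic has a perfect matching.
   Context: All graphs are finite, simple (no loops, no multiple edges) and undirected. For a graph $G$ on $n$ vertices with adjacency matrix $A_G$, its characteristic polynomial is $\chi_G(\lambda)=\det(\lambda I-A_G)=a_0\lambda^n+a_1\lambda^{n-1}+\dots+a_n$ (so $a_0=1$). $G$ is palindromic if $a_i=a_{n-i}$ for all $i=0,\dots,n$, and antipalindromic if $a_i=-a_{n-i}$ for all $i=0,\dots,n$. -}

module Defs where

open import Data.Nat using (ℕ; zero; suc; _∸_; _≤_)
open import Data.Integer using (ℤ; +_; -_) renaming (_+_ to _+ℤ_; _*_ to _*ℤ_)
open import Data.Fin using (Fin; zero; suc; punchIn)
open import Data.Fin.Properties using () renaming (_≟_ to _≟F_)
open import Data.Bool using (Bool; true; false; if_then_else_)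
open import Data.List using (List; []; _∷_; map; foldr; tabulate)
open import Relation.Nullary using (yes; no; ¬_)
open import Relation.Binary.PropositionalEquality using (_≡_)

record Graph (n : ℕ) : Set where
  field
    adj   : Fin n → Fin n → Bool
    sym   : ∀ i j → adj i j ≡ adj j i
    irrefl : ∀ i → adj i i ≡ false
open Graph public

adjMatrix : ∀ {n} → Graph n → Fin n → Fin n → ℤ
adjMatrix G i j = if adj G i j then + 1 else + 0

-- Polynomials over ℤ in the variable λ, as coefficient lists,
-- lowest degree first: a₀ ∷ a₁ ∷ … represents a₀ + a₁ λ + …

Poly : Set
Poly = List ℤ

_+P_ : Poly → Poly → Poly
[] +P q = q
(a ∷ p) +P [] = a ∷ p
(a ∷ p) +P (b ∷ q) = (a +ℤ b) ∷ (p +P q)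

negP : Poly → Poly
negP = map -_

_*P_ : Poly → Poly → Poly
[] *P q = []
(a ∷ p) *P q = map (a *ℤ_) q +P (+ 0 ∷ (p *P q))

constP : ℤ → Poly
constP a = a ∷ []

varP : Poly
varP = + 0 ∷ + 1 ∷ []

sumP : List Poly → Poly
sumP = foldr _+P_ []

coeff : Poly → ℕ → ℤ
coeff [] k = + 0
coeff (a ∷ p) zero = a
coeff (a ∷ p) (suc k) = coeff p k

signP : ℕ → Poly → Poly
signP zero p = p
signP (suc k) p = negP (signP k p)

toℕ' : ∀ {n} → Fin n → ℕ
toℕ' zero = zero
toℕ' (suc i) = suc (toℕ' i)

det : (n : ℕ) → (Fin n → Fin n → Poly) → Poly
det zero M = constP (+ 1)
det (suc n) M =
  sumP (tabulate λ j →
    signP (toℕ' j) (M zero j *P det n (λ r c → M (suc r) (punchIn j c))))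

charMatrix : ∀ {n} → Graph n → Fin n → Fin n → Poly
charMatrix G i j with i ≟F j
... | yes _ = varP +P negP (constP (adjMatrix G i j))
... | no  _ = negP (constP (adjMatrix G i j))

charPoly : ∀ {n} → Graph n → Poly
charPoly {n} G = det n (charMatrix G)

a : ∀ {n} → Graph n → ℕ → ℤ
a {n} G i = coeff (charPoly G) (n ∸ i)

Palindromic : ∀ {n} → Graph n → Set
Palindromic {n} G = ∀ i → i ≤ n → a G i ≡ a G (n ∸ i)

Antipalindromic : ∀ {n} → Graph n → Set
Antipalindromic {n} G = ∀ i → i ≤ n → a G i ≡ - a G (n ∸ i)

-- Perfect matching, given by the partner map: every vertex i is matched
-- to a unique neighbour m i ≠ i, and the partner of m i is i.

record PerfectMatching {n : ℕ} (G : Graph n) : Set where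
  field
    partner     : Fin n → Fin n
    isEdge      : ∀ i → adj G i (partner i) ≡ true
    involutive  : ∀ i → partner (partner i) ≡ i

{-# OPTIONS --safe #-}
-- Work modulo 2, where signs disappear: the constant coefficient of det(λI − A) becomes the
-- permanent of the adjacency matrix A, and the leading coefficient is 1.  (Anti)palindromy says
-- that these two coefficients agree up to sign, so per A is odd.  Expanding per A along its first
-- row and first column, the cross terms indexed by (i, j) and (j, i) cancel because A is symmetric,
-- and the corner term vanishes because A has zero diagonal; what is left is
-- Σᵢ A₀ᵢ · per(A without rows and columns 0 and i).  Hence vertex 0 has a neighbour i whose
-- removal together with 0 leaves an induced subgraph with odd permanent, and recursion yields
-- the matching.

module Submission where

open import Defs hiding (sym)
open import Algebra.Bundles using (CommutativeSemiring)
import Algebra.Properties.Semiring.Sum as SemiringSum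
open import Data.Bool using (true; if_then_else_)
open import Data.Fin using (Fin; zero; suc; punchIn; punchOut)
open import Data.Fin.Properties
  using (_≟_; suc-injective; punchInᵢ≢i; punchIn-punchOut; punchOut-punchIn; punchOut-cong)
open import Data.Integer as ℤ using (ℤ; +_; -[1+_]; ∣_∣; _⊖_)
open import Data.Integer.Properties using ([1+m]⊖[1+n]≡m⊖n; ∣-i∣≡∣i∣; abs-*)
open import Data.List using ([]; _∷_; map; tabulate)
open import Data.Nat as ℕ using (ℕ; zero; suc; parity; s≤s; z≤n)
import Data.Nat.Properties as ℕP
open import Data.Parity.Base as ℙ using (Parity; 0ℙ; 1ℙ)
import Data.Parity.Properties as ℙP
open import Data.Product using (_×_; _,_; ∃-syntax)
open import Data.Sum using (_⊎_; inj₁; inj₂)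
open import Function using (_∘_)
open import Relation.Nullary using (Dec; yes; no; contradiction)
import Relation.Binary.PropositionalEquality as ≡
open ≡ using (_≡_; _≢_)

-- Permanents over a commutative semiring

minor : ∀ {a} {A : Set a} {n} → (Fin (suc n) → Fin (suc n) → A) →
        Fin (suc n) → Fin (suc n) → Fin n → Fin n → A
minor M i j r c = M (punchIn i r) (punchIn j c)

module Permanent {c ℓ} (R : CommutativeSemiring c ℓ) where

  open CommutativeSemiring R hiding (zero)
  open import Algebra.Properties.CommutativeSemigroup *-commutativeSemigroup using (x∙yz≈y∙xz)
  open SemiringSum semiring
  open import Relation.Binary.Reasoning.Setoid setoid

  perm : ∀ n → (Fin n → Fin n → Carrier) → Carrier
  perm zero    M = 1#
  perm (suc n) M = ∑[ j < suc n ] (M zero j * perm n (minor M zero j))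

  perm-cong : ∀ n {M N : Fin n → Fin n → Carrier} →
              (∀ i j → M i j ≈ N i j) → perm n M ≈ perm n N
  perm-cong zero    M≈N = refl
  perm-cong (suc n) M≈N =
    sum-cong-≋ (λ j → *-cong (M≈N zero j) (perm-cong n (λ r c → M≈N (suc r) (punchIn j c))))

  perm-identity : ∀ n (M : Fin n → Fin n → Carrier) → (∀ i → M i i ≈ 1#) →
                  (∀ i j → i ≢ j → M i j ≈ 0#) → perm n M ≈ 1#
  perm-identity zero    M diag off = refl
  perm-identity (suc n) M diag off = begin
    M zero zero * perm n (minor M zero zero) + ∑[ j < n ] (M zero (suc j) * perm n (minor M zero (suc j)))
      ≈⟨ +-cong (*-cong (diag zero) minor-identity) off-row ⟩
    1# * 1# + 0#  ≈⟨ +-identityʳ _ ⟩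
    1# * 1#       ≈⟨ *-identityˡ 1# ⟩
    1#            ∎
    where
    minor-identity : perm n (minor M zero zero) ≈ 1#
    minor-identity = perm-identity n (minor M zero zero) (λ i → diag (suc i))
                       (λ i j i≢j → off (suc i) (suc j) (i≢j ∘ suc-injective))
    off-row : ∑[ j < n ] (M zero (suc j) * perm n (minor M zero (suc j))) ≈ 0#
    off-row = trans (sum-cong-≋ (λ j → trans (*-congʳ (off zero (suc j) λ ())) (zeroˡ _)))
                    (sum-replicate-zero n)

  perm-cauchy-expansion : ∀ n (M : Fin (suc (suc n)) → Fin (suc (suc n)) → Carrier) →
    perm (suc (suc n)) M ≈
      M zero zero * perm (suc n) (minor M zero zero) +
      ∑[ j < suc n ] ∑[ i < suc n ]
        (M zero (suc j) * (M (suc i) zero * perm n (minor (minor M zero zero) i j)))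
  perm-expand-column : ∀ n (M : Fin (suc n) → Fin (suc n) → Carrier) →
    perm (suc n) M ≈ ∑[ i < suc n ] (M i zero * perm n (minor M i zero))

  perm-cauchy-expansion n M = +-congˡ (sum-cong-≋ λ j → begin
    M zero (suc j) * perm (suc n) (minor M zero (suc j))
      ≈⟨ *-congˡ (perm-expand-column n (minor M zero (suc j))) ⟩
    M zero (suc j) * ∑[ i < suc n ] (M (suc i) zero * perm n (minor (minor M zero zero) i j))
      ≈⟨ *-distribˡ-sum (M zero (suc j))
                         (λ i → M (suc i) zero * perm n (minor (minor M zero zero) i j)) ⟩
    ∑[ i < suc n ] (M zero (suc j) * (M (suc i) zero * perm n (minor (minor M zero zero) i j))) ∎)

  perm-expand-column zero    M = refl
  perm-expand-column (suc n) M = trans (perm-cauchy-expansion n M) (+-congˡ (begin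
    ∑[ j < suc n ] ∑[ i < suc n ] (row j * (col i * Q i j))
      ≈⟨ ∑-comm (λ j i → row j * (col i * Q i j)) ⟩
    ∑[ i < suc n ] ∑[ j < suc n ] (row j * (col i * Q i j))
      ≈⟨ sum-cong-≋ (λ i → sum-cong-≋ {x = λ j → row j * (col i * Q i j)}
                                       (λ j → x∙yz≈y∙xz (row j) (col i) (Q i j))) ⟩
    ∑[ i < suc n ] ∑[ j < suc n ] (col i * (row j * Q i j))
      ≈⟨ sum-cong-≋ (λ i → sym (*-distribˡ-sum (col i) (λ j → row j * Q i j))) ⟩
    ∑[ i < suc n ] (col i * ∑[ j < suc n ] (row j * Q i j))  ∎))
    where
    row col : Fin (suc n) → Carrier
    row j = M zero (suc j)
    col i = M (suc i) zero
    Q : Fin (suc n) → Fin (suc n) → Carrier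
    Q i j = perm n (minor (minor M zero zero) i j)

  perm-transpose : ∀ n (M : Fin n → Fin n → Carrier) → perm n (λ i j → M j i) ≈ perm n M
  perm-transpose zero    M = refl
  perm-transpose (suc n) M = begin
    perm (suc n) (λ i j → M j i)
      ≈⟨ sum-cong-≋ (λ j → *-congˡ {M j zero} (perm-transpose n (minor M j zero))) ⟩
    ∑[ j < suc n ] (M j zero * perm n (minor M j zero))
      ≈⟨ perm-expand-column n M ⟨
    perm (suc n) M  ∎

  perm-minor-swap : ∀ n (M : Fin (suc n) → Fin (suc n) → Carrier) → (∀ i j → M i j ≈ M j i) →
                    ∀ i j → perm n (minor M i j) ≈ perm n (minor M j i)
  perm-minor-swap n M M-sym i j =
    trans (perm-cong n (λ r c → M-sym (punchIn i r) (punchIn j c))) (perm-transpose n (minor M j i))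

  module Characteristic2 (x+x≈0 : ∀ x → x + x ≈ 0#) where

    ∑∑-symmetric : ∀ n (f : Fin n → Fin n → Carrier) → (∀ i j → f i j ≈ f j i) →
                   ∑[ i < n ] ∑[ j < n ] f i j ≈ ∑[ i < n ] f i i
    ∑∑-symmetric zero    f f-sym = refl
    ∑∑-symmetric (suc n) f f-sym = begin
      (f zero zero + row) + ∑[ i < n ] (f (suc i) zero + ∑[ j < n ] f (suc i) (suc j))
        ≈⟨ +-congˡ (∑-distrib-+ (λ i → f (suc i) zero) _) ⟩
      (f zero zero + row) + (row′ + rest)      ≈⟨ +-assoc _ _ _ ⟩
      f zero zero + (row + (row′ + rest))      ≈⟨ +-congˡ (sym (+-assoc row row′ rest)) ⟩
      f zero zero + ((row + row′) + rest)
        ≈⟨ +-congˡ (+-congʳ (trans (+-congˡ (sym row≈row′)) (x+x≈0 row))) ⟩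
      f zero zero + (0# + rest)                ≈⟨ +-congˡ (+-identityˡ rest) ⟩
      f zero zero + rest
        ≈⟨ +-congˡ (∑∑-symmetric n (λ i j → f (suc i) (suc j)) (λ i j → f-sym (suc i) (suc j))) ⟩
      f zero zero + ∑[ i < n ] f (suc i) (suc i) ∎
      where
      row row′ rest : Carrier
      row  = ∑[ j < n ] f zero (suc j)
      row′ = ∑[ i < n ] f (suc i) zero
      rest = ∑[ i < n ] ∑[ j < n ] f (suc i) (suc j)
      row≈row′ : row ≈ row′
      row≈row′ = sum-cong-≋ (λ j → f-sym zero (suc j))

    perm-symmetric-expansion : ∀ n (M : Fin (suc (suc n)) → Fin (suc (suc n)) → Carrier) →
      (∀ i j → M i j ≈ M j i) → (∀ i → M i i ≈ 0#) →
      perm (suc (suc n)) M ≈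
        ∑[ i < suc n ] (M zero (suc i) * (M zero (suc i) * perm n (minor (minor M zero zero) i i)))
    perm-symmetric-expansion n M M-sym M-diag = begin
      perm (suc (suc n)) M
        ≈⟨ perm-cauchy-expansion n M ⟩
      M zero zero * perm (suc n) (minor M zero zero) + ∑[ j < suc n ] ∑[ i < suc n ] f j i
        ≈⟨ +-congʳ (trans (*-congʳ (M-diag zero)) (zeroˡ _)) ⟩
      0# + ∑[ j < suc n ] ∑[ i < suc n ] f j i
        ≈⟨ +-identityˡ _ ⟩
      ∑[ j < suc n ] ∑[ i < suc n ] f j i
        ≈⟨ ∑∑-symmetric (suc n) f f-sym ⟩
      ∑[ i < suc n ] f i i
        ≈⟨ sum-cong-≋ (λ i → *-congˡ {M zero (suc i)} (*-congʳ {Q i i} (M-sym (suc i) zero))) ⟩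
      ∑[ i < suc n ] (M zero (suc i) * (M zero (suc i) * Q i i)) ∎
      where
      Q : Fin (suc n) → Fin (suc n) → Carrier
      Q i j = perm n (minor (minor M zero zero) i j)
      f : Fin (suc n) → Fin (suc n) → Carrier
      f j i = M zero (suc j) * (M (suc i) zero * Q i j)
      Q-sym : ∀ i j → Q i j ≈ Q j i
      Q-sym = perm-minor-swap n (minor M zero zero) (λ r c → M-sym (suc r) (suc c))
      f-sym : ∀ j i → f j i ≈ f i j
      f-sym j i = begin
        M zero (suc j) * (M (suc i) zero * Q i j)  ≈⟨ *-congˡ (*-congʳ (M-sym (suc i) zero)) ⟩
        M zero (suc j) * (M zero (suc i) * Q i j)  ≈⟨ x∙yz≈y∙xz _ _ _ ⟩
        M zero (suc i) * (M zero (suc j) * Q i j)  ≈⟨ *-congˡ (*-cong (M-sym zero (suc j)) (Q-sym i j)) ⟩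
        M zero (suc i) * (M (suc j) zero * Q j i)  ∎

open ≡ using (refl; sym; trans; cong; cong₂; subst; module ≡-Reasoning)

-- Parity of integers and of polynomial coefficients

parityℤ : ℤ → Parity
parityℤ i = parity ∣ i ∣

parity-suc+suc : ∀ m n → parity (suc m) ℙ.+ parity (suc n) ≡ parity m ℙ.+ parity n
parity-suc+suc m n = begin
  parity (suc m) ℙ.+ parity (suc n)  ≡⟨ ℙP.+-homo-+ (suc m) (suc n) ⟨
  parity (suc m ℕ.+ suc n)           ≡⟨ cong parity (ℕP.+-suc (suc m) n) ⟩
  parity (m ℕ.+ n)                   ≡⟨ ℙP.+-homo-+ m n ⟩
  parity m ℙ.+ parity n              ∎
  where open ≡-Reasoning

parityℤ-⊖ : ∀ m n → parityℤ (m ⊖ n) ≡ parity m ℙ.+ parity n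
parityℤ-⊖ zero    zero    = refl
parityℤ-⊖ zero    (suc n) = refl
parityℤ-⊖ (suc m) zero    = sym (ℙP.+-identityʳ _)
parityℤ-⊖ (suc m) (suc n) = trans (cong parityℤ ([1+m]⊖[1+n]≡m⊖n m n))
                              (trans (parityℤ-⊖ m n) (sym (parity-suc+suc m n)))

parityℤ-homo-+ : ∀ i j → parityℤ (i ℤ.+ j) ≡ parityℤ i ℙ.+ parityℤ j
parityℤ-homo-+ (+ m)    (+ n)    = ℙP.+-homo-+ m n
parityℤ-homo-+ (+ m)    -[1+ n ] = parityℤ-⊖ m (suc n)
parityℤ-homo-+ -[1+ m ] (+ n)    = trans (parityℤ-⊖ n (suc m)) (ℙP.+-comm (parity n) (parity (suc m)))
parityℤ-homo-+ -[1+ m ] -[1+ n ] = trans (ℙP.+-homo-+ m n) (sym (parity-suc+suc m n))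

parityℤ-homo-* : ∀ i j → parityℤ (i ℤ.* j) ≡ parityℤ i ℙ.* parityℤ j
parityℤ-homo-* i j = trans (cong parity (abs-* i j)) (ℙP.*-homo-* ∣ i ∣ ∣ j ∣)

parityℤ-neg : ∀ i → parityℤ (ℤ.- i) ≡ parityℤ i
parityℤ-neg i = cong parity (∣-i∣≡∣i∣ i)

coeff₂ : Poly → ℕ → Parity
coeff₂ p k = parityℤ (coeff p k)

coeff₂-+P : ∀ p q k → coeff₂ (p +P q) k ≡ coeff₂ p k ℙ.+ coeff₂ q k
coeff₂-+P []      q       k       = refl
coeff₂-+P (x ∷ p) []      k       = sym (ℙP.+-identityʳ _)
coeff₂-+P (x ∷ p) (y ∷ q) zero    = parityℤ-homo-+ x y
coeff₂-+P (x ∷ p) (y ∷ q) (suc k) = coeff₂-+P p q k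

coeff₂-negP : ∀ p k → coeff₂ (negP p) k ≡ coeff₂ p k
coeff₂-negP []      k       = refl
coeff₂-negP (x ∷ p) zero    = parityℤ-neg x
coeff₂-negP (x ∷ p) (suc k) = coeff₂-negP p k

coeff₂-signP : ∀ s p k → coeff₂ (signP s p) k ≡ coeff₂ p k
coeff₂-signP zero    p k = refl
coeff₂-signP (suc s) p k = trans (coeff₂-negP (signP s p) k) (coeff₂-signP s p k)

coeff₂-scale : ∀ a q k → coeff₂ (map (a ℤ.*_) q) k ≡ parityℤ a ℙ.* coeff₂ q k
coeff₂-scale a []      k       = sym (ℙP.*-zeroʳ _)
coeff₂-scale a (x ∷ q) zero    = parityℤ-homo-* a x
coeff₂-scale a (x ∷ q) (suc k) = coeff₂-scale a q k

coeff₂-∷-*P : ∀ x p q k →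
  coeff₂ ((x ∷ p) *P q) k ≡ parityℤ x ℙ.* coeff₂ q k ℙ.+ coeff₂ (+ 0 ∷ (p *P q)) k
coeff₂-∷-*P x p q k = trans (coeff₂-+P (map (x ℤ.*_) q) _ k) (cong (ℙ._+ _) (coeff₂-scale x q k))

coeff₂-*P-0 : ∀ p q → coeff₂ (p *P q) 0 ≡ coeff₂ p 0 ℙ.* coeff₂ q 0
coeff₂-*P-0 []      q = refl
coeff₂-*P-0 (x ∷ p) q = trans (coeff₂-∷-*P x p q 0) (ℙP.+-identityʳ _)

AllEven : Poly → Set
AllEven p = ∀ k → coeff₂ p k ≡ 0ℙ

∷-AllEven : ∀ {p} → AllEven p → AllEven (+ 0 ∷ p)
∷-AllEven p-even zero    = refl
∷-AllEven p-even (suc k) = p-even k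

*P-AllEven : ∀ p q → AllEven p → AllEven (p *P q)
*P-AllEven []      q p-even k = refl
*P-AllEven (x ∷ p) q p-even k =
  trans (coeff₂-∷-*P x p q k)
        (cong₂ (λ a b → a ℙ.* coeff₂ q k ℙ.+ b) (p-even 0)
               (∷-AllEven (*P-AllEven p q (p-even ∘ suc)) k))

Deg₂≤ : Poly → ℕ → Set
Deg₂≤ p d = ∀ k → d ℕ.< k → coeff₂ p k ≡ 0ℙ

Deg₂≤-tail : ∀ {x p d} → Deg₂≤ (x ∷ p) (suc d) → Deg₂≤ p d
Deg₂≤-tail deg k d<k = deg (suc k) (s≤s d<k)

Deg₂≤0-tail : ∀ {x p} → Deg₂≤ (x ∷ p) 0 → AllEven p
Deg₂≤0-tail deg k = deg (suc k) (s≤s z≤n)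

coeff₂-∷-*P-above : ∀ x p q {k t} → Deg₂≤ q k → k ℕ.< t →
  coeff₂ ((x ∷ p) *P q) t ≡ coeff₂ (+ 0 ∷ (p *P q)) t
coeff₂-∷-*P-above x p q deg k<t =
  trans (coeff₂-∷-*P x p q _)
        (cong (ℙ._+ _) (trans (cong (parityℤ x ℙ.*_) (deg _ k<t)) (ℙP.*-zeroʳ _)))

*P-Deg₂≤ : ∀ p q m k → Deg₂≤ p m → Deg₂≤ q k → Deg₂≤ (p *P q) (m ℕ.+ k)
*P-Deg₂≤ []      q m       k p-deg q-deg t       _ = refl
*P-Deg₂≤ (x ∷ p) q zero    k p-deg q-deg t       k<t =
  trans (coeff₂-∷-*P-above x p q q-deg k<t) (∷-AllEven (*P-AllEven p q (Deg₂≤0-tail p-deg)) t)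
*P-Deg₂≤ (x ∷ p) q (suc m) k p-deg q-deg (suc t) (s≤s m+k<t) =
  trans (coeff₂-∷-*P-above x p q q-deg (s≤s (ℕP.≤-trans (ℕP.m≤n+m k m) (ℕP.<⇒≤ m+k<t))))
        (*P-Deg₂≤ p q m k (Deg₂≤-tail p-deg) q-deg t m+k<t)

coeff₂-*P-top : ∀ p q m k → Deg₂≤ p m → Deg₂≤ q k →
  coeff₂ (p *P q) (m ℕ.+ k) ≡ coeff₂ p m ℙ.* coeff₂ q k
coeff₂-*P-top []      q m       k p-deg q-deg = refl
coeff₂-*P-top (x ∷ p) q zero    k p-deg q-deg =
  trans (coeff₂-∷-*P x p q k)
        (trans (cong (parityℤ x ℙ.* coeff₂ q k ℙ.+_) (∷-AllEven (*P-AllEven p q (Deg₂≤0-tail p-deg)) k))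
               (ℙP.+-identityʳ _))
coeff₂-*P-top (x ∷ p) q (suc m) k p-deg q-deg =
  trans (coeff₂-∷-*P-above x p q q-deg (s≤s (ℕP.m≤n+m k m)))
        (coeff₂-*P-top p q m k (Deg₂≤-tail p-deg) q-deg)

-- Determinants modulo 2

open Permanent ℙP.+-*-commutativeSemiring
open Permanent.Characteristic2 ℙP.+-*-commutativeSemiring ℙP.p+p≡0ℙ
open SemiringSum ℙP.+-*-semiring using (sum; sum-syntax; sum-cong-≗; sum-replicate-zero)

sum-0ℙ : ∀ {n} {f : Fin n → Parity} → (∀ i → f i ≡ 0ℙ) → sum f ≡ 0ℙ
sum-0ℙ {n} f≡0 = trans (sum-cong-≗ f≡0) (sum-replicate-zero n)

sum≡1ℙ⇒∃ : ∀ {n} (f : Fin n → Parity) → sum f ≡ 1ℙ → ∃[ i ] f i ≡ 1ℙ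
sum≡1ℙ⇒∃ {suc n} f ∑f≡1 with f zero in f₀≡
... | 1ℙ = zero , f₀≡
... | 0ℙ with sum≡1ℙ⇒∃ (f ∘ suc) ∑f≡1
...   | i , fᵢ≡1 = suc i , fᵢ≡1

p*q≡1ℙ⇒p≡1ℙ×q≡1ℙ : ∀ {p q} → p ℙ.* q ≡ 1ℙ → p ≡ 1ℙ × q ≡ 1ℙ
p*q≡1ℙ⇒p≡1ℙ×q≡1ℙ {1ℙ} {1ℙ} _ = refl , refl

coeff₂-sumP : ∀ n (f : Fin n → Poly) k → coeff₂ (sumP (tabulate f)) k ≡ ∑[ j < n ] coeff₂ (f j) k
coeff₂-sumP zero    f k = refl
coeff₂-sumP (suc n) f k =
  trans (coeff₂-+P (f zero) _ k) (cong (coeff₂ (f zero) k ℙ.+_) (coeff₂-sumP n (f ∘ suc) k))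

coeff₂-det-suc : ∀ n (M : Fin (suc n) → Fin (suc n) → Poly) k →
  coeff₂ (det (suc n) M) k ≡ ∑[ j < suc n ] coeff₂ (M zero j *P det n (minor M zero j)) k
coeff₂-det-suc n M k =
  trans (coeff₂-sumP (suc n) (λ j → signP (toℕ' j) (term j)) k)
        (sum-cong-≗ (λ j → coeff₂-signP (toℕ' j) (term j) k))
  where
  term : Fin (suc n) → Poly
  term j = M zero j *P det n (minor M zero j)

coeff₂-det-0 : ∀ n (M : Fin n → Fin n → Poly) → coeff₂ (det n M) 0 ≡ perm n (λ i j → coeff₂ (M i j) 0)
coeff₂-det-0 zero    M = refl
coeff₂-det-0 (suc n) M = trans (coeff₂-det-suc n M 0) (sum-cong-≗ λ j →
  trans (coeff₂-*P-0 (M zero j) (det n (minor M zero j)))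
        (cong (coeff₂ (M zero j) 0 ℙ.*_) (coeff₂-det-0 n (minor M zero j))))

det-Deg₂≤ : ∀ n (M : Fin n → Fin n → Poly) → (∀ i j → Deg₂≤ (M i j) 1) → Deg₂≤ (det n M) n
det-Deg₂≤ zero    M deg (suc k) _   = refl
det-Deg₂≤ (suc n) M deg k       n<k = trans (coeff₂-det-suc n M k) (sum-0ℙ λ j →
  *P-Deg₂≤ (M zero j) (det n (minor M zero j)) 1 n
           (deg zero j) (det-Deg₂≤ n (minor M zero j) (λ r c → deg (suc r) (punchIn j c))) k n<k)

coeff₂-det-top : ∀ n (M : Fin n → Fin n → Poly) → (∀ i j → Deg₂≤ (M i j) 1) →
  coeff₂ (det n M) n ≡ perm n (λ i j → coeff₂ (M i j) 1)
coeff₂-det-top zero    M deg = refl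
coeff₂-det-top (suc n) M deg = trans (coeff₂-det-suc n M (suc n)) (sum-cong-≗ λ j →
  trans (coeff₂-*P-top (M zero j) (det n (minor M zero j)) 1 n
                       (deg zero j) (det-Deg₂≤ n (minor M zero j) (minor-deg j)))
        (cong (coeff₂ (M zero j) 1 ℙ.*_) (coeff₂-det-top n (minor M zero j) (minor-deg j))))
  where
  minor-deg : ∀ j r c → Deg₂≤ (minor M zero j r c) 1
  minor-deg j r c = deg (suc r) (punchIn j c)

coeff₂≥2≡0ℙ⇒Deg₂≤1 : ∀ p → (∀ k → coeff₂ p (suc (suc k)) ≡ 0ℙ) → Deg₂≤ p 1
coeff₂≥2≡0ℙ⇒Deg₂≤1 p above (suc (suc k)) _ = above k
coeff₂≥2≡0ℙ⇒Deg₂≤1 p above (suc zero) (s≤s ())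

charMatrix-Deg₂≤1 : ∀ {n} (G : Graph n) i j → Deg₂≤ (charMatrix G i j) 1
charMatrix-Deg₂≤1 G i j with i ≟ j
... | yes _ = coeff₂≥2≡0ℙ⇒Deg₂≤1 (varP +P negP (constP (adjMatrix G i j))) (λ _ → refl)
... | no  _ = coeff₂≥2≡0ℙ⇒Deg₂≤1 (negP (constP (adjMatrix G i j))) (λ _ → refl)

adjacency₂ : ∀ {n} → Graph n → Fin n → Fin n → Parity
adjacency₂ G i j = parityℤ (adjMatrix G i j)

adjacency₂-sym : ∀ {n} (G : Graph n) i j → adjacency₂ G i j ≡ adjacency₂ G j i
adjacency₂-sym G i j = cong (λ b → parityℤ (if b then + 1 else + 0)) (Graph.sym G i j)

adjacency₂-diagonal : ∀ {n} (G : Graph n) i → adjacency₂ G i i ≡ 0ℙ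
adjacency₂-diagonal G i = cong (λ b → parityℤ (if b then + 1 else + 0)) (irrefl G i)

adjacency₂≡1ℙ⇒edge : ∀ {n} (G : Graph n) i j → adjacency₂ G i j ≡ 1ℙ → adj G i j ≡ true
adjacency₂≡1ℙ⇒edge G i j = odd-bit (adj G i j)
  where
  odd-bit : ∀ b → parityℤ (if b then + 1 else + 0) ≡ 1ℙ → b ≡ true
  odd-bit true _ = refl

coeff₂-charMatrix-0 : ∀ {n} (G : Graph n) i j → coeff₂ (charMatrix G i j) 0 ≡ adjacency₂ G i j
coeff₂-charMatrix-0 G i j with i ≟ j
... | yes _ = trans (parityℤ-homo-+ (+ 0) (ℤ.- adjMatrix G i j)) (parityℤ-neg (adjMatrix G i j))
... | no  _ = parityℤ-neg (adjMatrix G i j)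

coeff₂-charMatrix-1-diagonal : ∀ {n} (G : Graph n) i → coeff₂ (charMatrix G i i) 1 ≡ 1ℙ
coeff₂-charMatrix-1-diagonal G i with i ≟ i
... | yes _   = refl
... | no  i≢i = contradiction refl i≢i

coeff₂-charMatrix-1-off : ∀ {n} (G : Graph n) i j → i ≢ j → coeff₂ (charMatrix G i j) 1 ≡ 0ℙ
coeff₂-charMatrix-1-off G i j i≢j with i ≟ j
... | yes i≡j = contradiction i≡j i≢j
... | no  _   = refl

coeff₂-charPoly-top : ∀ {n} (G : Graph n) → coeff₂ (charPoly G) n ≡ 1ℙ
coeff₂-charPoly-top {n} G =
  trans (coeff₂-det-top n (charMatrix G) (charMatrix-Deg₂≤1 G))
        (perm-identity n _ (coeff₂-charMatrix-1-diagonal G) (coeff₂-charMatrix-1-off G))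

coeff₂-charPoly-0 : ∀ {n} (G : Graph n) → coeff₂ (charPoly G) 0 ≡ perm n (adjacency₂ G)
coeff₂-charPoly-0 {n} G = trans (coeff₂-det-0 n (charMatrix G)) (perm-cong n (coeff₂-charMatrix-0 G))

coeff₂-charPoly-top≡0 : ∀ {n} (G : Graph n) → Palindromic G ⊎ Antipalindromic G →
                        coeff₂ (charPoly G) n ≡ coeff₂ (charPoly G) 0
coeff₂-charPoly-top≡0 {n} G sym-coeffs =
  trans (parity-a₀≡parity-aₙ sym-coeffs) (cong (coeff₂ (charPoly G)) (ℕP.n∸n≡0 n))
  where
  parity-a₀≡parity-aₙ : Palindromic G ⊎ Antipalindromic G → parityℤ (a G 0) ≡ parityℤ (a G n)
  parity-a₀≡parity-aₙ (inj₁ palindromic)     = cong parityℤ (palindromic 0 z≤n)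
  parity-a₀≡parity-aₙ (inj₂ antipalindromic) =
    trans (cong parityℤ (antipalindromic 0 z≤n)) (parityℤ-neg (a G n))

-- Perfect matchings from an odd permanent

induced : ∀ {m n} → Graph n → (Fin m → Fin n) → Graph m
induced G f = record
  { adj    = λ i j → adj G (f i) (f j)
  ; sym    = λ i j → Graph.sym G (f i) (f j)
  ; irrefl = λ i → irrefl G (f i)
  }

extend-perfectMatching : ∀ {m} (G : Graph (suc (suc m))) (i : Fin (suc m)) →
  adj G zero (suc i) ≡ true → PerfectMatching (induced G (suc ∘ punchIn i)) → PerfectMatching G
extend-perfectMatching {m} G i edge₀ matching = record
  { partner = partner ; isEdge = isEdge ; involutive = involutive }
  where
  open PerfectMatching matching renaming (partner to partner′; isEdge to isEdge′; involutive to involutive′)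

  partnerOf : ∀ k → Dec (i ≡ k) → Fin (suc (suc m))
  partnerOf k (yes _)   = zero
  partnerOf k (no  i≢k) = suc (punchIn i (partner′ (punchOut i≢k)))

  partner : Fin (suc (suc m)) → Fin (suc (suc m))
  partner zero    = suc i
  partner (suc k) = partnerOf k (i ≟ k)

  isEdgeOf : ∀ k (d : Dec (i ≡ k)) → adj G (suc k) (partnerOf k d) ≡ true
  isEdgeOf k (yes refl) = trans (Graph.sym G (suc i) zero) edge₀
  isEdgeOf k (no  i≢k)  =
    subst (λ x → adj G (suc x) (partnerOf k (no i≢k)) ≡ true)
          (punchIn-punchOut i≢k) (isEdge′ (punchOut i≢k))

  isEdge : ∀ k → adj G k (partner k) ≡ true
  isEdge zero    = edge₀
  isEdge (suc k) = isEdgeOf k (i ≟ k)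

  partnerOf-i : (d : Dec (i ≡ i)) → partnerOf i d ≡ zero
  partnerOf-i (yes _)   = refl
  partnerOf-i (no  i≢i) = contradiction refl i≢i

  partnerOf-punchIn : ∀ x (d : Dec (i ≡ punchIn i x)) →
                      partnerOf (punchIn i x) d ≡ suc (punchIn i (partner′ x))
  partnerOf-punchIn x (yes i≡iₓ) = contradiction (sym i≡iₓ) (punchInᵢ≢i i x)
  partnerOf-punchIn x (no  i≢iₓ) =
    cong (λ y → suc (punchIn i (partner′ y))) (trans (punchOut-cong i refl) (punchOut-punchIn i))

  involutiveOf : ∀ k (d : Dec (i ≡ k)) → partner (partnerOf k d) ≡ suc k
  involutiveOf k (yes refl) = refl
  involutiveOf k (no  i≢k)  = begin
    partnerOf (punchIn i x′) (i ≟ punchIn i x′)  ≡⟨ partnerOf-punchIn x′ (i ≟ punchIn i x′) ⟩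
    suc (punchIn i (partner′ x′))                 ≡⟨ cong (suc ∘ punchIn i) (involutive′ (punchOut i≢k)) ⟩
    suc (punchIn i (punchOut i≢k))                ≡⟨ cong suc (punchIn-punchOut i≢k) ⟩
    suc k                                         ∎
    where
    open ≡-Reasoning
    x′ : Fin m
    x′ = partner′ (punchOut i≢k)

  involutive : ∀ k → partner (partner k) ≡ k
  involutive zero    = partnerOf-i (i ≟ i)
  involutive (suc k) = involutiveOf k (i ≟ k)

odd-perm⇒edge : ∀ m (G : Graph (suc (suc m))) → perm (suc (suc m)) (adjacency₂ G) ≡ 1ℙ →
  ∃[ i ] adj G zero (suc i) ≡ true × perm m (adjacency₂ (induced G (suc ∘ punchIn i))) ≡ 1ℙ
odd-perm⇒edge m G odd = edge-of (sum≡1ℙ⇒∃ term (trans (sym expansion) odd))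
  where
  A : Fin (suc (suc m)) → Fin (suc (suc m)) → Parity
  A = adjacency₂ G
  term : Fin (suc m) → Parity
  term i = A zero (suc i) ℙ.* (A zero (suc i) ℙ.* perm m (minor (minor A zero zero) i i))
  expansion : perm (suc (suc m)) A ≡ sum term
  expansion = perm-symmetric-expansion m A (adjacency₂-sym G) (adjacency₂-diagonal G)
  edge-of : ∃[ i ] term i ≡ 1ℙ →
            ∃[ i ] adj G zero (suc i) ≡ true × perm m (adjacency₂ (induced G (suc ∘ punchIn i))) ≡ 1ℙ
  edge-of (i , termᵢ≡1) =
    let edge , rest = p*q≡1ℙ⇒p≡1ℙ×q≡1ℙ termᵢ≡1
        _ , minor-odd = p*q≡1ℙ⇒p≡1ℙ×q≡1ℙ rest
    in  i , adjacency₂≡1ℙ⇒edge G zero (suc i) edge , minor-odd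

odd-perm⇒perfectMatching : ∀ n (G : Graph n) → perm n (adjacency₂ G) ≡ 1ℙ → PerfectMatching G
odd-perm⇒perfectMatching zero G _ = record { partner = λ () ; isEdge = λ () ; involutive = λ () }
odd-perm⇒perfectMatching (suc zero) G odd
  with trans (sym odd) (cong (λ p → p ℙ.* 1ℙ ℙ.+ 0ℙ) (adjacency₂-diagonal G zero))
... | ()
odd-perm⇒perfectMatching (suc (suc m)) G odd =
  let i , edge , minor-odd = odd-perm⇒edge m G odd
  in  extend-perfectMatching G i edge
        (odd-perm⇒perfectMatching m (induced G (suc ∘ punchIn i)) minor-odd)

proposition2 : (n : ℕ) (G : Graph n) → Palindromic G ⊎ Antipalindromic G → PerfectMatching G
proposition2 n G sym-coeffs = odd-perm⇒perfectMatching n G (begin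
  perm n (adjacency₂ G)     ≡⟨ coeff₂-charPoly-0 G ⟨
  coeff₂ (charPoly G) 0     ≡⟨ coeff₂-charPoly-top≡0 G sym-coeffs ⟨
  coeff₂ (charPoly G) n     ≡⟨ coeff₂-charPoly-top G ⟩
  1ℙ                        ∎)
  where open ≡-Reasoning
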